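{- Let $G$ be a $3$-non-compliant graph on $14$ vertices, and let $u,v\in V(G)$ be distinct non-adjacent vertices with $\deg_G(u)=\deg_G(v)=7$. Then $|N_G(u)\cap N_G(v)|\ge 4$.
   Context: All graphs are finite, simple and undirected; $\overline{G}$ denotes the complement of $G$; $N_G(u)$ is the set of vertices adjacent to $u$. A minor of $G$ is a graph obtained from $G$ by a sequence of vertex deletions, edge deletions and edge contractions. $\Delta(H)$ is the maximum degree of $H$. A graph $G$ on $n$ vertices is $3$-non-compliant if neither $G$ nor $\overline{G}$ has a minor $H$ with $\Delta(H)\ge n-3$. -}

module Defs where

open import Data.Nat using (ℕ; zero; suc; _+_; _∸_; _≤_; _⊔_)
open import Data.Fin using (Fin; punchIn; _≟_)
open import Data.List using (List; map; foldr; allFin)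
open import Data.Nat.ListAction using (sum)
open import Data.Bool using (Bool; true; false; not; _∧_; _∨_; if_then_else_)
open import Data.Bool.Properties using (∨-comm)
open import Data.Product using (Σ; _×_)
open import Relation.Nullary using (¬_; does; yes; no)
open import Relation.Binary.PropositionalEquality using (_≡_; refl; sym; cong; cong₂)

record Graph (n : ℕ) : Set where
  field
    adj    : Fin n → Fin n → Bool
    adjSym : ∀ a b → adj a b ≡ adj b a
    adjIrr : ∀ a → adj a a ≡ false
open Graph public

eqb : ∀ {n} → Fin n → Fin n → Bool
eqb a b = does (a ≟ b)

neqb : ∀ {n} → Fin n → Fin n → Bool
neqb a b = not (eqb a b)

eqb-sym : ∀ {n} (a b : Fin n) → eqb a b ≡ eqb b a
eqb-sym a b with a ≟ b | b ≟ a
... | yes _ | yes _ = refl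
... | no _  | no _  = refl
... | yes p | no q  with q (sym p)
...   | ()
eqb-sym a b | no p | yes q with p (sym q)
...   | ()

eqb-refl : ∀ {n} (a : Fin n) → eqb a a ≡ true
eqb-refl a with a ≟ a
... | yes _ = refl
... | no p with p refl
...   | ()

mkGraph : ∀ {n} → (Fin n → Fin n → Bool) → Graph n
mkGraph r = record
  { adj    = λ a b → neqb a b ∧ (r a b ∨ r b a)
  ; adjSym = λ a b → cong₂ _∧_ (cong not (eqb-sym a b)) (∨-comm (r a b) (r b a))
  ; adjIrr = λ a → irr a
  }
  where
  irr : ∀ a → neqb a a ∧ (r a a ∨ r a a) ≡ false
  irr a with a ≟ a
  ... | yes _ = refl
  ... | no p with p refl
  ...   | ()

compl : ∀ {n} → Graph n → Graph n
compl G = mkGraph (λ a b → not (adj G a b))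

deg : ∀ {n} → Graph n → Fin n → ℕ
deg {n} G u = sum (map (λ w → if adj G u w then 1 else 0) (allFin n))

commonNbrs : ∀ {n} → Graph n → Fin n → Fin n → ℕ
commonNbrs {n} G u v = sum (map (λ w → if adj G u w ∧ adj G v w then 1 else 0) (allFin n))

maxDeg : ∀ {n} → Graph n → ℕ
maxDeg {n} G = foldr _⊔_ 0 (map (deg G) (allFin n))

deleteVertex : ∀ {n} → Graph (suc n) → Fin (suc n) → Graph n
deleteVertex G j = mkGraph (λ a b → adj G (punchIn j a) (punchIn j b))

deleteEdge : ∀ {n} → Graph n → Fin n → Fin n → Graph n
deleteEdge G i j = mkGraph (λ a b → adj G a b ∧ not (eqb a i ∧ eqb b j) ∧ not (eqb a j ∧ eqb b i))

-- Contract the edge {punchIn j i, j}: vertex j is merged into vertex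
-- punchIn j i (which becomes i in the new labelling).
contractEdge : ∀ {n} → Graph (suc n) → Fin (suc n) → Fin n → Graph n
contractEdge G j i = mkGraph (λ a b → adj G (punchIn j a) (punchIn j b) ∨ (eqb a i ∧ adj G j (punchIn j b)))

data Step : ∀ {n m} → Graph n → Graph m → Set where
  delV : ∀ {n} (G : Graph (suc n)) (j : Fin (suc n)) → Step G (deleteVertex G j)
  delE : ∀ {n} (G : Graph n) (i j : Fin n) → Step G (deleteEdge G i j)
  contr : ∀ {n} (G : Graph (suc n)) (j : Fin (suc n)) (i : Fin n) →
          adj G (punchIn j i) j ≡ true → Step G (contractEdge G j i)

data Minor : ∀ {m n} → Graph m → Graph n → Set where
  done : ∀ {n} (G : Graph n) → Minor G G
  step : ∀ {m n k} {H : Graph m} {G : Graph n} {G' : Graph k} →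
         Step G G' → Minor H G' → Minor H G

HasMinorΔ≥ : ∀ {n} → ℕ → Graph n → Set
HasMinorΔ≥ {n} k G = Σ ℕ λ m → Σ (Graph m) λ H → Minor H G × (n ∸ k ≤ maxDeg H)

NonCompliant3 : ∀ {n} → Graph n → Set
NonCompliant3 G = ¬ HasMinorΔ≥ 3 G × ¬ HasMinorΔ≥ 3 (compl G)

{-# OPTIONS --safe #-}
module Submission where

-- Contracting both edges of a path a – c – b whose vertices dominate the graph leaves a vertex
-- adjacent to all n − 3 others, so neither a 3-non-compliant graph nor its complement has
-- such a dominating path.  When deg u + deg v = n, inclusion–exclusion shows that u and v have
-- exactly as many common neighbours as there are vertices adjacent to neither of them, u and v
-- included.  With at most three common neighbours, at most one vertex d ∉ {u, v} is adjacent to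
-- neither: then u – w – v dominates G for a common neighbour w adjacent to d (any w if there is
-- no d), and if no such w exists, u – d – v dominates the complement.

open import Defs
open import Data.Bool using (Bool; true; false; not; _∧_; _∨_; if_then_else_)
import Data.Bool as Bool
open import Data.Bool.Properties
  using (∧-conicalˡ; ∧-conicalʳ; ∨-conicalˡ; ∨-conicalʳ; ∨-zeroʳ; not-injective; ¬-not)
open import Data.Empty using (⊥-elim)
open import Data.Fin using (Fin; zero; suc; punchIn; punchOut; _≟_)
open import Data.Fin.Properties using (punchIn-punchOut; punchInᵢ≢i; punchIn-injective; any?)
open import Data.List using (map; foldr; allFin; tabulate)
open import Data.List.Membership.Propositional using (_∈_)
open import Data.List.Membership.Propositional.Properties using (∈-map⁺; ∈-allFin)
open import Data.List.Properties using (map-tabulate)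
open import Data.List.Relation.Unary.Any using (here; there)
open import Data.Nat using (ℕ; zero; suc; _+_; _⊔_; _≤_; z≤n; s≤s; s≤s⁻¹; _≤?_)
open import Data.Nat.ListAction using (sum)
open import Data.Nat.Properties
  using (≤-refl; ≤-trans; +-mono-≤; m≤m⊔n; m≤n⊔m; +-cancelˡ-≡; suc-injective; ≰⇒>;
         +-commutativeSemigroup; module ≤-Reasoning)
open import Algebra.Properties.CommutativeSemigroup +-commutativeSemigroup
  using (interchange; x∙yz≈y∙xz)
open import Data.Product using (∃; _×_; _,_; proj₁; proj₂)
open import Data.Sum using (_⊎_; inj₁; inj₂; [_,_]′)
open import Function using (_∘_; id)
open import Relation.Nullary using (¬_; yes; no; contradiction)
open import Relation.Nullary.Decidable using (dec-false; decidable-stable)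
open import Relation.Binary.PropositionalEquality
  using (_≡_; _≢_; refl; sym; trans; cong; cong₂; subst; module ≡-Reasoning)

neqb≡true : ∀ {n} {a b : Fin n} → a ≢ b → neqb a b ≡ true
neqb≡true {a = a} {b} a≢b = cong not (dec-false (a ≟ b) a≢b)

neqb≡true⇒≢ : ∀ {n} {a b : Fin n} → neqb a b ≡ true → a ≢ b
neqb≡true⇒≢ {a = a} e refl with () ← trans (sym e) (cong not (eqb-refl a))

adj⇒≢ : ∀ {n} (G : Graph n) {a b : Fin n} → adj G a b ≡ true → a ≢ b
adj⇒≢ G {a} e refl with () ← trans (sym e) (adjIrr G a)

adj-mkGraph : ∀ {n} {r : Fin n → Fin n → Bool} {a b : Fin n} →
              a ≢ b → r a b ≡ true → adj (mkGraph r) a b ≡ true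
adj-mkGraph {r = r} {a} {b} a≢b e = cong₂ _∧_ (neqb≡true a≢b) (cong (_∨ r b a) e)

adj-compl : ∀ {n} (G : Graph n) {a b : Fin n} → a ≢ b → adj G a b ≡ false → adj (compl G) a b ≡ true
adj-compl G a≢b e = adj-mkGraph {r = λ a b → not (adj G a b)} a≢b (cong not e)

∈⇒≤foldr-⊔ : ∀ {m ms} → m ∈ ms → m ≤ foldr _⊔_ 0 ms
∈⇒≤foldr-⊔ (here refl) = m≤m⊔n _ _
∈⇒≤foldr-⊔ (there m∈ms) = ≤-trans (∈⇒≤foldr-⊔ m∈ms) (m≤n⊔m _ _)

deg≤maxDeg : ∀ {n} (G : Graph n) (x : Fin n) → deg G x ≤ maxDeg G
deg≤maxDeg G x = ∈⇒≤foldr-⊔ (∈-map⁺ (deg G) (∈-allFin x))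

indicator : Bool → ℕ
indicator b = if b then 1 else 0

count : ∀ {n} → (Fin n → Bool) → ℕ
count {zero}  P = 0
count {suc n} P = indicator (P zero) + count (P ∘ suc)

sum-tabulate-indicator : ∀ {n} (P : Fin n → Bool) → sum (tabulate (indicator ∘ P)) ≡ count P
sum-tabulate-indicator {zero}  P = refl
sum-tabulate-indicator {suc n} P = cong (indicator (P zero) +_) (sum-tabulate-indicator (P ∘ suc))

sum-indicator : ∀ {n} (P : Fin n → Bool) → sum (map (indicator ∘ P) (allFin n)) ≡ count P
sum-indicator P = trans (cong sum (map-tabulate id (indicator ∘ P))) (sum-tabulate-indicator P)

count-cong : ∀ {n} {P Q : Fin n → Bool} → (∀ x → P x ≡ Q x) → count P ≡ count Q
count-cong {zero}  P≗Q = refl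
count-cong {suc n} P≗Q = cong₂ _+_ (cong indicator (P≗Q zero)) (count-cong (P≗Q ∘ suc))

count-true : ∀ n → count {n} (λ _ → true) ≡ n
count-true zero    = refl
count-true (suc n) = cong suc (count-true n)

indicator-mono : ∀ {p q} → (p ≡ true → q ≡ true) → indicator p ≤ indicator q
indicator-mono {false} p⇒q = z≤n
indicator-mono {true}  p⇒q with refl ← p⇒q refl = ≤-refl

count-mono : ∀ {n} {P Q : Fin n → Bool} → (∀ x → P x ≡ true → Q x ≡ true) → count P ≤ count Q
count-mono {zero}  P⇒Q = z≤n
count-mono {suc n} P⇒Q = +-mono-≤ (indicator-mono (P⇒Q zero)) (count-mono (P⇒Q ∘ suc))

count>0⇒∃ : ∀ {n} {P : Fin n → Bool} → 1 ≤ count P → ∃ λ x → P x ≡ true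
count>0⇒∃ {zero} ()
count>0⇒∃ {suc n} {P} pos with P zero in P0
... | true  = zero , P0
... | false with count>0⇒∃ pos
...   | x , Px = suc x , Px

count-punchIn : ∀ {n} (P : Fin (suc n) → Bool) (j : Fin (suc n)) →
                count P ≡ indicator (P j) + count (P ∘ punchIn j)
count-punchIn P zero = refl
count-punchIn {suc n} P (suc j) = begin
  indicator (P zero) + count (P ∘ suc)
    ≡⟨ cong (indicator (P zero) +_) (count-punchIn (P ∘ suc) j) ⟩
  indicator (P zero) + (indicator (P (suc j)) + count (P ∘ suc ∘ punchIn j))
    ≡⟨ x∙yz≈y∙xz (indicator (P zero)) (indicator (P (suc j))) _ ⟩
  indicator (P (suc j)) + (indicator (P zero) + count (P ∘ suc ∘ punchIn j))  ∎
  where open ≡-Reasoning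

count-∨+count-∧ : ∀ {n} (P Q : Fin n → Bool) →
                  count (λ x → P x ∨ Q x) + count (λ x → P x ∧ Q x) ≡ count P + count Q
count-∨+count-∧ {zero}  P Q = refl
count-∨+count-∧ {suc n} P Q = begin
  (indicator (p ∨ q) + count (λ x → P (suc x) ∨ Q (suc x))) +
  (indicator (p ∧ q) + count (λ x → P (suc x) ∧ Q (suc x)))
    ≡⟨ interchange (indicator (p ∨ q)) _ _ _ ⟩
  (indicator (p ∨ q) + indicator (p ∧ q)) +
  (count (λ x → P (suc x) ∨ Q (suc x)) + count (λ x → P (suc x) ∧ Q (suc x)))
    ≡⟨ cong₂ _+_ (indicator-∨+∧ p q) (count-∨+count-∧ (P ∘ suc) (Q ∘ suc)) ⟩
  (indicator p + indicator q) + (count (P ∘ suc) + count (Q ∘ suc))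
    ≡⟨ interchange (indicator p) _ _ _ ⟩
  (indicator p + count (P ∘ suc)) + (indicator q + count (Q ∘ suc))  ∎
  where
  open ≡-Reasoning
  p = P zero
  q = Q zero
  indicator-∨+∧ : ∀ p q → indicator (p ∨ q) + indicator (p ∧ q) ≡ indicator p + indicator q
  indicator-∨+∧ false false = refl
  indicator-∨+∧ false true  = refl
  indicator-∨+∧ true  false = refl
  indicator-∨+∧ true  true  = refl

count+count-not : ∀ {n} (P : Fin n → Bool) → count P + count (not ∘ P) ≡ n
count+count-not {zero}  P = refl
count+count-not {suc n} P = begin
  (indicator (P zero) + count (P ∘ suc)) + (indicator (not (P zero)) + count (not ∘ P ∘ suc))
    ≡⟨ interchange (indicator (P zero)) _ _ _ ⟩
  (indicator (P zero) + indicator (not (P zero))) + (count (P ∘ suc) + count (not ∘ P ∘ suc))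
    ≡⟨ cong₂ _+_ (indicator+indicator-not (P zero)) (count+count-not (P ∘ suc)) ⟩
  suc n  ∎
  where
  open ≡-Reasoning
  indicator+indicator-not : ∀ p → indicator p + indicator (not p) ≡ 1
  indicator+indicator-not false = refl
  indicator+indicator-not true  = refl

count-∧≡count-¬∨ : ∀ {n} {P Q : Fin n → Bool} → count P + count Q ≡ n →
                   count (λ x → P x ∧ Q x) ≡ count (λ x → not (P x ∨ Q x))
count-∧≡count-¬∨ {n} {P} {Q} P+Q≡n = +-cancelˡ-≡ (count P∨Q) _ _ (begin
  count P∨Q + count (λ x → P x ∧ Q x)  ≡⟨ count-∨+count-∧ P Q ⟩
  count P + count Q                    ≡⟨ P+Q≡n ⟩
  n                                    ≡⟨ count+count-not P∨Q ⟨
  count P∨Q + count (not ∘ P∨Q)        ∎)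
  where
  open ≡-Reasoning
  P∨Q : Fin n → Bool
  P∨Q x = P x ∨ Q x

_∖_ : ∀ {n} → (Fin n → Bool) → Fin n → (Fin n → Bool)
(P ∖ a) x = neqb a x ∧ P x

∖-intro : ∀ {n} {P : Fin n → Bool} {a x : Fin n} → a ≢ x → P x ≡ true → (P ∖ a) x ≡ true
∖-intro a≢x Px = cong₂ _∧_ (neqb≡true a≢x) Px

∖-elim : ∀ {n} {P : Fin n → Bool} {a x : Fin n} → (P ∖ a) x ≡ true → a ≢ x × P x ≡ true
∖-elim {a = a} {x} e = neqb≡true⇒≢ (∧-conicalˡ (neqb a x) _ e) , ∧-conicalʳ (neqb a x) _ e

count-∖ : ∀ {n} {P : Fin n → Bool} {a : Fin n} → P a ≡ true → count P ≡ suc (count (P ∖ a))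
count-∖ {suc n} {P} {a} Pa =
  trans (count-punchIn P a) (cong₂ _+_ (cong indicator Pa) (sym count-P∖a))
  where
  open ≡-Reasoning
  count-P∖a : count (P ∖ a) ≡ count (P ∘ punchIn a)
  count-P∖a = begin
    count (P ∖ a)
      ≡⟨ count-punchIn (P ∖ a) a ⟩
    indicator (neqb a a ∧ P a) + count ((P ∖ a) ∘ punchIn a)
      ≡⟨ cong₂ _+_ (cong (λ b → indicator (not b ∧ P a)) (eqb-refl a)) (count-cong λ x →
           cong (_∧ P (punchIn a x)) (neqb≡true (punchInᵢ≢i a x ∘ sym))) ⟩
    count (P ∘ punchIn a)  ∎

count≤1⇒unique : ∀ {n} {P : Fin n → Bool} → count P ≤ 1 → ∀ {a b} → P a ≡ true → P b ≡ true → a ≡ b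
count≤1⇒unique {P = P} P≤1 {a} {b} Pa Pb = decidable-stable (a ≟ b) λ a≢b →
  contradiction (subst (_≤ 1) (count-P≡2+ a≢b) P≤1) λ { (s≤s ()) }
  where
  count-P≡2+ : a ≢ b → count P ≡ 2 + count ((P ∖ a) ∖ b)
  count-P≡2+ a≢b = trans (count-∖ {P = P} Pa) (cong suc (count-∖ {P = P ∖ a} (∖-intro {P = P} a≢b Pb)))

Step⇒HasMinorΔ≥-suc : ∀ {n k} {G : Graph (suc n)} {G′ : Graph n} →
                      Step G G′ → HasMinorΔ≥ k G′ → HasMinorΔ≥ (suc k) G
Step⇒HasMinorΔ≥-suc G→G′ (m , H , H≼G′ , bound) = m , H , step G→G′ H≼G′ , bound

universal⇒HasMinorΔ≥1 : ∀ {m} (H : Graph (suc m)) (x : Fin (suc m)) →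
                        (∀ y → x ≢ y → adj H x y ≡ true) → HasMinorΔ≥ 1 H
universal⇒HasMinorΔ≥1 {m} H x universal = _ , H , done H , (begin
  m                 ≡⟨ suc-injective (trans (sym (count-true (suc m)))
                                            (count-∖ {P = all} {a = x} refl)) ⟩
  count (all ∖ x)   ≤⟨ count-mono (λ y e → universal y (proj₁ (∖-elim {P = all} {a = x} e))) ⟩
  count (adj H x)   ≡⟨ sum-indicator (adj H x) ⟨
  deg H x           ≤⟨ deg≤maxDeg H x ⟩
  maxDeg H          ∎)
  where
  open ≤-Reasoning
  all : Fin (suc m) → Bool
  all _ = true

-- Contracting the edge xy merges y into x, which is called x′ in H/xy.
module Contraction {n} (H : Graph (suc n)) {x y : Fin (suc n)} (x≢y : x ≢ y) where

  x′ : Fin n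
  x′ = punchOut (x≢y ∘ sym)

  H/xy : Graph n
  H/xy = contractEdge H y x′

  contracted : Fin n → Fin n → Bool
  contracted a b = adj H (punchIn y a) (punchIn y b) ∨ (eqb a x′ ∧ adj H y (punchIn y b))

  punchIn-x′ : punchIn y x′ ≡ x
  punchIn-x′ = punchIn-punchOut (x≢y ∘ sym)

  punchIn-≢x : ∀ {b} → x′ ≢ b → punchIn y b ≢ x
  punchIn-≢x x′≢b e = x′≢b (punchIn-injective y x′ _ (trans punchIn-x′ (sym e)))

  contract-step : adj H x y ≡ true → Step H H/xy
  contract-step xy = contr H y x′ (subst (λ z → adj H z y ≡ true) (sym punchIn-x′) xy)

  adj-kept : ∀ {a b} → a ≢ b → adj H (punchIn y a) (punchIn y b) ≡ true → adj H/xy a b ≡ true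
  adj-kept {a} {b} a≢b e =
    adj-mkGraph {r = contracted} a≢b (cong (_∨ (eqb a x′ ∧ adj H y (punchIn y b))) e)

  adj-merged : ∀ {b} → x′ ≢ b → adj H x (punchIn y b) ≡ true ⊎ adj H y (punchIn y b) ≡ true →
               adj H/xy x′ b ≡ true
  adj-merged {b} x′≢b (inj₁ xb) =
    adj-kept x′≢b (subst (λ z → adj H z (punchIn y b) ≡ true) (sym punchIn-x′) xb)
  adj-merged {b} x′≢b (inj₂ yb) = adj-mkGraph {r = contracted} x′≢b
    (trans (cong (adj H (punchIn y x′) (punchIn y b) ∨_) (cong₂ _∧_ (eqb-refl x′) yb)) (∨-zeroʳ _))

dominatingEdge⇒HasMinorΔ≥2 : ∀ {m} (H : Graph (2 + m)) {x y} → adj H x y ≡ true →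
  (∀ z → z ≢ x → z ≢ y → adj H x z ≡ true ⊎ adj H y z ≡ true) → HasMinorΔ≥ 2 H
dominatingEdge⇒HasMinorΔ≥2 H {x} {y} xy dom =
  Step⇒HasMinorΔ≥-suc {k = 1} (contract-step xy) (universal⇒HasMinorΔ≥1 H/xy x′ λ b x′≢b →
    adj-merged x′≢b (dom (punchIn y b) (punchIn-≢x x′≢b) (punchInᵢ≢i y b)))
  where open Contraction H (adj⇒≢ H xy)

dominatingPath⇒HasMinorΔ≥3 : ∀ {m} (H : Graph (3 + m)) {a c b} →
  adj H a c ≡ true → adj H c b ≡ true → a ≢ b →
  (∀ z → z ≢ a → z ≢ c → z ≢ b → adj H a z ≡ true ⊎ adj H c z ≡ true ⊎ adj H b z ≡ true) →
  HasMinorΔ≥ 3 H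
dominatingPath⇒HasMinorΔ≥3 H {a} {c} {b} ac cb a≢b dom =
  Step⇒HasMinorΔ≥-suc {k = 2} (contract-step ac) (dominatingEdge⇒HasMinorΔ≥2 H/xy x′b′ dom′)
  where
  open Contraction H (adj⇒≢ H ac)
  b′ : Fin _
  b′ = punchOut (adj⇒≢ H cb)
  punchIn-b′ : punchIn c b′ ≡ b
  punchIn-b′ = punchIn-punchOut (adj⇒≢ H cb)
  x′≢b′ : x′ ≢ b′
  x′≢b′ e = a≢b (trans (sym punchIn-x′) (trans (cong (punchIn c) e) punchIn-b′))
  x′b′ : adj H/xy x′ b′ ≡ true
  x′b′ = adj-merged x′≢b′ (inj₂ (subst (λ z → adj H c z ≡ true) (sym punchIn-b′) cb))
  dom′ : ∀ z → z ≢ x′ → z ≢ b′ → adj H/xy x′ z ≡ true ⊎ adj H/xy b′ z ≡ true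
  dom′ z z≢x′ z≢b′ with dom (punchIn c z) (punchIn-≢x (z≢x′ ∘ sym)) (punchInᵢ≢i c z)
                            (λ e → z≢b′ (punchIn-injective c z b′ (trans e (sym punchIn-b′))))
  ... | inj₁ az        = inj₁ (adj-merged (z≢x′ ∘ sym) (inj₁ az))
  ... | inj₂ (inj₁ cz) = inj₁ (adj-merged (z≢x′ ∘ sym) (inj₂ cz))
  ... | inj₂ (inj₂ bz) =
    inj₂ (adj-kept (z≢b′ ∘ sym) (subst (λ w → adj H w (punchIn c z) ≡ true) (sym punchIn-b′) bz))

module Neighbourhoods {n} (G : Graph n) (u v : Fin n) where

  common nonNbr far : Fin n → Bool
  common y = adj G u y ∧ adj G v y
  nonNbr y = not (adj G u y ∨ adj G v y)
  far = (nonNbr ∖ u) ∖ v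

  commonNbrs≡count-nonNbr : deg G u + deg G v ≡ n → commonNbrs G u v ≡ count nonNbr
  commonNbrs≡count-nonNbr degs = trans (sum-indicator common) (count-∧≡count-¬∨
    (trans (sym (cong₂ _+_ (sum-indicator (adj G u)) (sum-indicator (adj G v)))) degs))

  count-nonNbr : u ≢ v → adj G u v ≡ false → count nonNbr ≡ 2 + count far
  count-nonNbr u≢v uv =
    trans (count-∖ {P = nonNbr} nonNbr-u) (cong suc (count-∖ {P = nonNbr ∖ u} nonNbr-v))
    where
    nonNbr-u : nonNbr u ≡ true
    nonNbr-u = cong not (cong₂ _∨_ (adjIrr G u) (trans (adjSym G v u) uv))
    nonNbr-v : (nonNbr ∖ u) v ≡ true
    nonNbr-v = ∖-intro {P = nonNbr} u≢v (cong not (cong₂ _∨_ uv (adjIrr G v)))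

  far-intro : ∀ {y} → y ≢ u → y ≢ v → adj G u y ≡ false → adj G v y ≡ false → far y ≡ true
  far-intro y≢u y≢v uy vy =
    ∖-intro {P = nonNbr ∖ u} (y≢v ∘ sym)
      (∖-intro {P = nonNbr} (y≢u ∘ sym) (cong not (cong₂ _∨_ uy vy)))

  far-elim : ∀ {y} → far y ≡ true → y ≢ u × y ≢ v × adj G u y ≡ false × adj G v y ≡ false
  far-elim {y} e with ∖-elim {P = nonNbr ∖ u} e
  ... | v≢y , e′ with ∖-elim {P = nonNbr} e′
  ...   | u≢y , e″ = u≢y ∘ sym , v≢y ∘ sym , ∨-conicalˡ _ _ uy∨vy , ∨-conicalʳ _ _ uy∨vy
    where
    uy∨vy : adj G u y ∨ adj G v y ≡ false
    uy∨vy = not-injective e″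

module _ {m} (G : Graph (3 + m)) (u v : Fin (3 + m)) (u≢v : u ≢ v) where
  open Neighbourhoods G u v

  common-path⇒HasMinorΔ≥3 : ∀ {w} → common w ≡ true → (∀ {y} → far y ≡ true → adj G w y ≡ true) →
                            HasMinorΔ≥ 3 G
  common-path⇒HasMinorΔ≥3 {w} cw w-covers-far = dominatingPath⇒HasMinorΔ≥3 G
    (∧-conicalˡ _ _ cw) (trans (adjSym G w v) (∧-conicalʳ _ _ cw)) u≢v dom
    where
    dom : ∀ y → y ≢ u → y ≢ w → y ≢ v → adj G u y ≡ true ⊎ adj G w y ≡ true ⊎ adj G v y ≡ true
    dom y y≢u _ y≢v with adj G u y Bool.≟ true | adj G v y Bool.≟ true
    ... | yes uy | _      = inj₁ uy
    ... | no _   | yes vy = inj₂ (inj₂ vy)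
    ... | no uy  | no vy  = inj₂ (inj₁ (w-covers-far (far-intro y≢u y≢v (¬-not uy) (¬-not vy))))

  far-path⇒HasMinorΔ≥3ᶜ : ∀ {d} → far d ≡ true → (∀ {w} → common w ≡ true → adj G w d ≡ false) →
                          HasMinorΔ≥ 3 (compl G)
  far-path⇒HasMinorΔ≥3ᶜ {d} fd no-common-nbr with far-elim fd
  ... | d≢u , d≢v , ud , vd = dominatingPath⇒HasMinorΔ≥3 (compl G)
    (adj-compl G (d≢u ∘ sym) ud) (adj-compl G d≢v (trans (adjSym G d v) vd)) u≢v dom
    where
    dom : ∀ y → y ≢ u → y ≢ d → y ≢ v →
          adj (compl G) u y ≡ true ⊎ adj (compl G) d y ≡ true ⊎ adj (compl G) v y ≡ true
    dom y y≢u y≢d y≢v with adj G u y Bool.≟ true | adj G v y Bool.≟ true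
    ... | no uy  | _      = inj₁ (adj-compl G (y≢u ∘ sym) (¬-not uy))
    ... | yes _  | no vy  = inj₂ (inj₂ (adj-compl G (y≢v ∘ sym) (¬-not vy)))
    ... | yes uy | yes vy = inj₂ (inj₁ (adj-compl G (y≢d ∘ sym)
                            (trans (adjSym G d y) (no-common-nbr (cong₂ _∧_ uy vy)))))

  fewFar⇒HasMinorΔ≥3 : count far ≤ 1 → 1 ≤ count common → HasMinorΔ≥ 3 G ⊎ HasMinorΔ≥ 3 (compl G)
  fewFar⇒HasMinorΔ≥3 far≤1 common>0 with any? (λ y → far y Bool.≟ true)
  ... | no no-far =
    inj₁ (common-path⇒HasMinorΔ≥3 (proj₂ (count>0⇒∃ {P = common} common>0))
            λ {y} fy → ⊥-elim (no-far (y , fy)))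
  ... | yes (d , fd) with any? (λ w → common w ∧ adj G w d Bool.≟ true)
  ...   | yes (w , e) = inj₁ (common-path⇒HasMinorΔ≥3 (∧-conicalˡ _ _ e) λ fy →
            subst (λ z → adj G w z ≡ true) (count≤1⇒unique far≤1 fd fy) (∧-conicalʳ _ _ e))
  ...   | no none =
    inj₂ (far-path⇒HasMinorΔ≥3ᶜ fd λ {w} cw → ¬-not λ wd → none (w , cong₂ _∧_ cw wd))

lemma9 : (G : Graph 14) → NonCompliant3 G → (u v : Fin 14) → u ≢ v → adj G u v ≡ false →
           deg G u ≡ 7 → deg G v ≡ 7 → 4 ≤ commonNbrs G u v
lemma9 G (noMinor , noMinorᶜ) u v u≢v uv deg-u deg-v =
  decidable-stable (4 ≤? commonNbrs G u v) λ 4≰c →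
    [ noMinor , noMinorᶜ ]′ (fewFar⇒HasMinorΔ≥3 G u v u≢v (far≤1 4≰c) common>0)
  where
  open Neighbourhoods G u v
  common≡2+far : commonNbrs G u v ≡ 2 + count far
  common≡2+far = trans (commonNbrs≡count-nonNbr (cong₂ _+_ deg-u deg-v)) (count-nonNbr u≢v uv)
  common>0 : 1 ≤ count common
  common>0 = subst (1 ≤_) (trans (sym common≡2+far) (sum-indicator common)) (s≤s z≤n)
  far≤1 : ¬ 4 ≤ commonNbrs G u v → count far ≤ 1
  far≤1 4≰c = s≤s⁻¹ (≰⇒> λ 2≤far → 4≰c (subst (4 ≤_) (sym common≡2+far) (s≤s (s≤s 2≤far))))
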